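{- Let $z$ be a nonnegative integer. For every $m\ge0$, the number of $z$-asymmetric partitions of $m$ equals the number of partitions of $m$ into distinct parts each of the form $2k+1+z$ with $k\ge0$ an integer.
   Context: A partition $\lambda$ is $z$-asymmetric if in Frobenius coordinates $\lambda=(\alpha|\alpha+z)$: if $r$ is the rank of $\lambda$ (largest $r$ with $\lambda_r\ge r$), then $\alpha_i=\lambda_i-i$ and $\lambda'_i-i=\alpha_i+z$ for $1\le i\le r$, where $\lambda'$ is the conjugate partition; the empty partition is $z$-asymmetric. -}

module Defs where

open import Data.Bool using (Bool; true; false; _∧_; if_then_else_; T)
open import Data.Nat using (ℕ; zero; suc; _+_; _∸_; _≤ᵇ_; _≡ᵇ_; _⊔_; _≤?_; _%_)
open import Data.List using (List; []; _∷_; length; filter; map; upTo; foldr)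
open import Data.Bool.ListAction using (and)
open import Data.Nat.ListAction using (sum)

all : {A : Set} → (A → Bool) → List A → Bool
all p xs = and (map p xs)

weaklyDecreasing : List ℕ → Bool
weaklyDecreasing [] = true
weaklyDecreasing (x ∷ []) = true
weaklyDecreasing (x ∷ y ∷ r) = (y ≤ᵇ x) ∧ weaklyDecreasing (y ∷ r)

strictlyDecreasing : List ℕ → Bool
strictlyDecreasing [] = true
strictlyDecreasing (x ∷ []) = true
strictlyDecreasing (x ∷ y ∷ r) = (suc y ≤ᵇ x) ∧ strictlyDecreasing (y ∷ r)

isPartitionOf : ℕ → List ℕ → Bool
isPartitionOf m l = weaklyDecreasing l ∧ all (λ p → 1 ≤ᵇ p) l ∧ (sum l ≡ᵇ m)

-- λ_i (1-indexed); parts beyond the length are 0.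
part : List ℕ → ℕ → ℕ
part [] i = 0
part (x ∷ xs) zero = 0
part (x ∷ xs) (suc zero) = x
part (x ∷ xs) (suc (suc i)) = part xs (suc i)

conjPart : List ℕ → ℕ → ℕ
conjPart l j = length (filter (λ p → j ≤? p) l)

oneTo : ℕ → List ℕ
oneTo n = map suc (upTo n)

rank : List ℕ → ℕ
rank l = foldr (λ i acc → if i ≤ᵇ part l i then i ⊔ acc else acc) 0 (oneTo (length l))

-- z-asymmetric: for 1 ≤ i ≤ rank, λ'_i - i = (λ_i - i) + z
-- (both λ_i ≥ i and λ'_i ≥ i for i ≤ rank, so truncated subtraction is exact)
isZAsymmetric : ℕ → List ℕ → Bool
isZAsymmetric z l = all (λ i → (conjPart l i ∸ i) ≡ᵇ ((part l i ∸ i) + z)) (oneTo (rank l))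

isOddShift : ℕ → ℕ → Bool
isOddShift z p = (suc z ≤ᵇ p) ∧ (((p ∸ suc z) % 2) ≡ᵇ 0)

isDistinctOddShiftPartitionOf : ℕ → ℕ → List ℕ → Bool
isDistinctOddShiftPartitionOf z m l =
  strictlyDecreasing l ∧ all (isOddShift z) l ∧ (sum l ≡ᵇ m)

-- A z-asymmetric partition λ = (α | α + z) is determined by its Frobenius arms α₁ > ⋯ > α_r, and
-- every strictly decreasing list of arms arises: removing the first row and column of λ strips off
-- α₁ and leaves the z-asymmetric partition with arms α₂ > ⋯ > α_r, and conversely a first row of
-- length α₁ + 1 and a first column of height α₁ + z + 1 can be wrapped around that partition.
-- The diagonal hooks of λ partition its cells and the i-th one has 2αᵢ + 1 + z cells, so
-- λ ↦ (2αᵢ + 1 + z)ᵢ is the required bijection.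

module Submission where

open import Defs
open import Data.Bool using (Bool; true; false; T; _∧_; if_then_else_)
open import Data.Bool.ListAction using (and)
open import Data.Bool.Properties using (T-∧; T-irrelevant)
open import Data.Nat using (ℕ; zero; suc; _+_; _*_; _∸_; _≤ᵇ_; _<ᵇ_; _≡ᵇ_; _⊔_; _%_; _/_; _≤_; _<_; _>_; _≤′_; ≤′-refl; ≤′-step; z≤n; s≤s)
open import Data.Nat.Properties
open import Data.Nat.DivMod using (m*n%n≡0; m*n/n≡m; m≡m%n+[m/n]*n)
open import Data.Nat.Induction using (<-wellFounded)
open import Data.Nat.ListAction using (sum)
open import Data.Nat.ListAction.Properties using (sum-++)
open import Data.Nat.Tactic.RingSolver using (solve-∀)
open import Data.List using (List; []; _∷_; length; map; upTo; foldr; replicate; _++_; _∷ʳ_)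
open import Data.List.Properties using (map-∘; map-applyUpTo; applyUpTo-∷ʳ; foldr-∷ʳ; filter-accept; map-id-local; length-++; length-map; length-replicate; map-++)
open import Data.List.Relation.Unary.All as All using ()
open import Data.List.Relation.Unary.All.Properties as All using (all⁺; all⁻)
open import Data.List.Relation.Unary.Linked as Linked using (Linked; []; [-]; _∷_)
open import Data.List.Relation.Unary.Linked.Properties as Linked using ()
open import Data.Product using (Σ; ∃; _×_; _,_; proj₁; proj₂)
open import Function.Base using (_∘_)
open import Function.Bundles using (_↔_; mk↔ₛ′; Equivalence)
open import Function.Properties.Inverse using (↔-trans)
open import Induction.WellFounded using (Acc; acc)
open import Relation.Binary.PropositionalEquality
open ≡-Reasoning

∧-intro : ∀ {a b} → T a → T b → T (a ∧ b)
∧-intro p q = Equivalence.from T-∧ (p , q)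

∧-elim : ∀ {a b} → T (a ∧ b) → T a × T b
∧-elim = Equivalence.to T-∧

data Partition≤ (b : ℕ) : List ℕ → Set where
  []   : Partition≤ b []
  cons : ∀ {x xs} → suc x ≤ b → Partition≤ (suc x) xs → Partition≤ b (suc x ∷ xs)

Partition≤-weaken : ∀ {b c xs} → b ≤ c → Partition≤ b xs → Partition≤ c xs
Partition≤-weaken b≤c []           = []
Partition≤-weaken b≤c (cons x≤b p) = cons (≤-trans x≤b b≤c) p

Partition≤⇒weaklyDecreasing : ∀ {b xs} → Partition≤ b xs → T (weaklyDecreasing xs)
Partition≤⇒weaklyDecreasing []                      = _
Partition≤⇒weaklyDecreasing (cons _ [])             = _
Partition≤⇒weaklyDecreasing (cons _ p@(cons y≤x _)) = ∧-intro (≤⇒≤ᵇ y≤x) (Partition≤⇒weaklyDecreasing p)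

Partition≤⇒positive : ∀ {b xs} → Partition≤ b xs → T (all (1 ≤ᵇ_) xs)
Partition≤⇒positive []         = _
Partition≤⇒positive (cons _ p) = Partition≤⇒positive p

decreasing⇒Partition≤ : ∀ x xs → T (weaklyDecreasing (x ∷ xs)) → T (all (1 ≤ᵇ_) (x ∷ xs)) →
                        Partition≤ x (x ∷ xs)
decreasing⇒Partition≤ zero    _  _   ()
decreasing⇒Partition≤ (suc x) [] _   _   = cons ≤-refl []
decreasing⇒Partition≤ (suc x) (y ∷ ys) dec pos =
  let y≤x , dec′ = ∧-elim dec in
  cons ≤-refl (Partition≤-weaken (≤ᵇ⇒≤ y (suc x) y≤x) (decreasing⇒Partition≤ y ys dec′ pos))

isPartitionOf⇒Partition≤ : ∀ {m} l → T (isPartitionOf m l) → (∃ λ b → Partition≤ b l) × sum l ≡ m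
isPartitionOf⇒Partition≤ {m} []       t = (0 , []) , ≡ᵇ⇒≡ 0 m t
isPartitionOf⇒Partition≤ {m} (x ∷ xs) t =
  let dec , rest = ∧-elim {weaklyDecreasing (x ∷ xs)} t
      pos , sum≡m = ∧-elim {all (1 ≤ᵇ_) (x ∷ xs)} rest
  in (x , decreasing⇒Partition≤ x xs dec pos) , ≡ᵇ⇒≡ _ m sum≡m

Partition≤⇒isPartitionOf : ∀ {m b l} → Partition≤ b l → sum l ≡ m → T (isPartitionOf m l)
Partition≤⇒isPartitionOf p sum≡m =
  ∧-intro (Partition≤⇒weaklyDecreasing p) (∧-intro (Partition≤⇒positive p) (≡⇒≡ᵇ _ _ sum≡m))

strictlyDecreasing⇒Linked : ∀ xs → T (strictlyDecreasing xs) → Linked _>_ xs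
strictlyDecreasing⇒Linked []           _ = []
strictlyDecreasing⇒Linked (x ∷ [])     _ = [-]
strictlyDecreasing⇒Linked (x ∷ y ∷ xs) t =
  let y<x , rest = ∧-elim {suc y ≤ᵇ x} t in
  ≤ᵇ⇒≤ (suc y) x y<x ∷ strictlyDecreasing⇒Linked (y ∷ xs) rest

Linked⇒strictlyDecreasing : ∀ {xs} → Linked _>_ xs → T (strictlyDecreasing xs)
Linked⇒strictlyDecreasing []          = _
Linked⇒strictlyDecreasing [-]         = _
Linked⇒strictlyDecreasing (y<x ∷ xs↓) = ∧-intro (≤⇒≤ᵇ y<x) (Linked⇒strictlyDecreasing xs↓)

-- The first column

dropFirstColumn : List ℕ → List ℕ
dropFirstColumn []                 = []
dropFirstColumn (suc (suc x) ∷ xs) = suc x ∷ dropFirstColumn xs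
dropFirstColumn (_ ∷ xs)           = dropFirstColumn xs

addFirstColumn : ℕ → List ℕ → List ℕ
addFirstColumn n μ = map suc μ ++ replicate (n ∸ length μ) 1

part-Partition≤ : ∀ {b l} → Partition≤ b l → ∀ i → part l i ≤ b
part-Partition≤ []           i             = z≤n
part-Partition≤ (cons x≤b p) zero          = z≤n
part-Partition≤ (cons x≤b p) (suc zero)    = x≤b
part-Partition≤ (cons x≤b p) (suc (suc i)) = ≤-trans (part-Partition≤ p (suc i)) x≤b

part-beyond-length : ∀ l {i} → length l < i → part l i ≡ 0
part-beyond-length []       _               = refl
part-beyond-length (x ∷ xs) {suc (suc i)} (s≤s l<i) = part-beyond-length xs l<i

Partition≤-1⇒replicate : ∀ {xs} → Partition≤ 1 xs → xs ≡ replicate (length xs) 1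
Partition≤-1⇒replicate []                   = refl
Partition≤-1⇒replicate (cons {zero} _ p)    = cong (1 ∷_) (Partition≤-1⇒replicate p)
Partition≤-1⇒replicate (cons {suc _} (s≤s ()) _)

dropFirstColumn-replicate-1 : ∀ k → dropFirstColumn (replicate k 1) ≡ []
dropFirstColumn-replicate-1 zero    = refl
dropFirstColumn-replicate-1 (suc k) = dropFirstColumn-replicate-1 k

dropFirstColumn-Partition≤-1 : ∀ {xs} → Partition≤ 1 xs → dropFirstColumn xs ≡ []
dropFirstColumn-Partition≤-1 {xs} p =
  trans (cong dropFirstColumn (Partition≤-1⇒replicate p)) (dropFirstColumn-replicate-1 (length xs))

part-dropFirstColumn : ∀ {b r} → Partition≤ b r → ∀ i → part (dropFirstColumn r) i ≡ part r i ∸ 1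
part-dropFirstColumn []                  i = refl
part-dropFirstColumn (cons {zero} _ p)   i rewrite dropFirstColumn-Partition≤-1 p with i
... | zero        = refl
... | suc zero    = refl
... | suc (suc i) = sym (m≤n⇒m∸n≡0 (part-Partition≤ p (suc i)))
part-dropFirstColumn (cons {suc x} _ p) zero          = refl
part-dropFirstColumn (cons {suc x} _ p) (suc zero)    = refl
part-dropFirstColumn (cons {suc x} _ p) (suc (suc i)) = part-dropFirstColumn p (suc i)

conjPart-dropFirstColumn : ∀ r j → conjPart (dropFirstColumn r) (suc j) ≡ conjPart r (suc (suc j))
conjPart-dropFirstColumn []                 j = refl
conjPart-dropFirstColumn (zero ∷ xs)        j = conjPart-dropFirstColumn xs j
conjPart-dropFirstColumn (suc zero ∷ xs)    j = conjPart-dropFirstColumn xs j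
conjPart-dropFirstColumn (suc (suc x) ∷ xs) j with j <ᵇ suc x
... | true  = cong suc (conjPart-dropFirstColumn xs j)
... | false = conjPart-dropFirstColumn xs j

conjPart-1 : ∀ {b r} → Partition≤ b r → conjPart r 1 ≡ length r
conjPart-1 []         = refl
conjPart-1 (cons _ p) = cong suc (conjPart-1 p)

length-dropFirstColumn : ∀ r → length (dropFirstColumn r) ≤ length r
length-dropFirstColumn []                 = z≤n
length-dropFirstColumn (zero ∷ xs)        = m≤n⇒m≤1+n (length-dropFirstColumn xs)
length-dropFirstColumn (suc zero ∷ xs)    = m≤n⇒m≤1+n (length-dropFirstColumn xs)
length-dropFirstColumn (suc (suc x) ∷ xs) = s≤s (length-dropFirstColumn xs)

dropFirstColumn-Partition≤ : ∀ {b r} → Partition≤ (suc b) r → Partition≤ b (dropFirstColumn r)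
dropFirstColumn-Partition≤ []                        = []
dropFirstColumn-Partition≤ (cons {zero} _ p)
  rewrite dropFirstColumn-Partition≤-1 p             = []
dropFirstColumn-Partition≤ (cons {suc x} (s≤s x<b) p) = cons x<b (dropFirstColumn-Partition≤ p)

addFirstColumn-dropFirstColumn : ∀ {b r} → Partition≤ b r → addFirstColumn (length r) (dropFirstColumn r) ≡ r
addFirstColumn-dropFirstColumn []                  = refl
addFirstColumn-dropFirstColumn (cons {zero} _ p)
  rewrite dropFirstColumn-Partition≤-1 p            = cong (1 ∷_) (sym (Partition≤-1⇒replicate p))
addFirstColumn-dropFirstColumn (cons {suc x} _ p)  = cong (suc (suc x) ∷_) (addFirstColumn-dropFirstColumn p)

dropFirstColumn-addFirstColumn : ∀ n {b μ} → Partition≤ b μ → dropFirstColumn (addFirstColumn n μ) ≡ μ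
dropFirstColumn-addFirstColumn n {μ = μ} p = drop-ones p (n ∸ length μ)
  where
  drop-ones : ∀ {b μ} → Partition≤ b μ → ∀ k → dropFirstColumn (map suc μ ++ replicate k 1) ≡ μ
  drop-ones []         k = dropFirstColumn-replicate-1 k
  drop-ones (cons _ p) k = cong (_ ∷_) (drop-ones p k)

addFirstColumn-Partition≤ : ∀ n {b μ} → Partition≤ b μ → Partition≤ (suc b) (addFirstColumn n μ)
addFirstColumn-Partition≤ n {μ = μ} p = shifted (n ∸ length μ) (s≤s z≤n) p
  where
  ones : ∀ {b} k → 1 ≤ b → Partition≤ b (replicate k 1)
  ones zero    _   = []
  ones (suc k) 1≤b = cons 1≤b (ones k ≤-refl)

  shifted : ∀ k {b μ} → 1 ≤ suc b → Partition≤ b μ → Partition≤ (suc b) (map suc μ ++ replicate k 1)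
  shifted k 1≤b []         = ones k 1≤b
  shifted k _   (cons x≤b p) = cons (s≤s x≤b) (shifted k (s≤s z≤n) p)

length-addFirstColumn : ∀ {n} μ → length μ ≤ n → length (addFirstColumn n μ) ≡ n
length-addFirstColumn {n} μ μ≤n = begin
  length (map suc μ ++ replicate (n ∸ length μ) 1)  ≡⟨ length-++ (map suc μ) ⟩
  length (map suc μ) + length (replicate (n ∸ length μ) 1)
    ≡⟨ cong₂ _+_ (length-map suc μ) (length-replicate (n ∸ length μ)) ⟩
  length μ + (n ∸ length μ)                          ≡⟨ m+[n∸m]≡n μ≤n ⟩
  n                                                  ∎

sum-map-suc : ∀ xs → sum (map suc xs) ≡ sum xs + length xs
sum-map-suc []       = refl
sum-map-suc (x ∷ xs) = begin
  suc (x + sum (map suc xs))   ≡⟨ cong (λ s → suc (x + s)) (sum-map-suc xs) ⟩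
  suc (x + (sum xs + length xs)) ≡⟨ reassoc x (sum xs) (length xs) ⟩
  x + sum xs + suc (length xs) ∎
  where
  reassoc : ∀ a b c → suc (a + (b + c)) ≡ a + b + suc c
  reassoc = solve-∀

sum-replicate-1 : ∀ k → sum (replicate k 1) ≡ k
sum-replicate-1 zero    = refl
sum-replicate-1 (suc k) = cong suc (sum-replicate-1 k)

sum-addFirstColumn : ∀ {n} μ → length μ ≤ n → sum (addFirstColumn n μ) ≡ sum μ + n
sum-addFirstColumn {n} μ μ≤n = begin
  sum (map suc μ ++ replicate (n ∸ length μ) 1)           ≡⟨ sum-++ (map suc μ) _ ⟩
  sum (map suc μ) + sum (replicate (n ∸ length μ) 1)
    ≡⟨ cong₂ _+_ (sum-map-suc μ) (sum-replicate-1 (n ∸ length μ)) ⟩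
  sum μ + length μ + (n ∸ length μ)                        ≡⟨ +-assoc (sum μ) _ _ ⟩
  sum μ + (length μ + (n ∸ length μ))                      ≡⟨ cong (sum μ +_) (m+[n∸m]≡n μ≤n) ⟩
  sum μ + n                                                ∎

oneTo-suc : ∀ n → oneTo (suc n) ≡ 1 ∷ map suc (oneTo n)
oneTo-suc n = cong (λ xs → 1 ∷ map suc xs) (sym (map-applyUpTo (λ i → i) suc n))

oneTo-∷ʳ : ∀ n → oneTo (suc n) ≡ oneTo n ∷ʳ suc n
oneTo-∷ʳ n = begin
  map suc (upTo (suc n))        ≡⟨ cong (map suc) (applyUpTo-∷ʳ (λ i → i) n) ⟨
  map suc (upTo n ∷ʳ n)         ≡⟨ map-++ suc (upTo n) (n ∷ []) ⟩
  oneTo n ∷ʳ suc n              ∎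

-- Rank, arms and legs

-- rank l is, by definition, largest (onDiagonal l) (oneTo (length l)).
largestStep : (ℕ → Bool) → ℕ → ℕ → ℕ
largestStep P i k = if P i then i ⊔ k else k

largest : (ℕ → Bool) → List ℕ → ℕ
largest P = foldr (largestStep P) 0

onDiagonal : List ℕ → ℕ → Bool
onDiagonal l i = i ≤ᵇ part l i

largest-≤ : ∀ P {b} xs → (∀ i → T (P i) → i ≤ b) → largest P xs ≤ b
largest-≤ P []       _ = z≤n
largest-≤ P (i ∷ xs) h with P i in Pi
... | true  = ⊔-lub (h i (subst T (sym Pi) _)) (largest-≤ P xs h)
... | false = largest-≤ P xs h

largest-map-suc : ∀ P Q xs → (∀ i → P (suc i) ≡ Q i) → 1 ⊔ largest P (map suc xs) ≡ suc (largest Q xs)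
largest-map-suc P Q []       h = refl
largest-map-suc P Q (i ∷ xs) h with P (suc i) | Q i | h i
... | false | false | refl = largest-map-suc P Q xs h
... | true  | true  | refl = begin
  1 ⊔ (suc i ⊔ L)   ≡⟨ ⊔-assoc 1 (suc i) L ⟨
  (1 ⊔ suc i) ⊔ L   ≡⟨ cong (_⊔ L) (⊔-comm 1 (suc i)) ⟩
  (suc i ⊔ 1) ⊔ L   ≡⟨ ⊔-assoc (suc i) 1 L ⟩
  suc i ⊔ (1 ⊔ L)   ≡⟨ cong (suc i ⊔_) (largest-map-suc P Q xs h) ⟩
  suc (i ⊔ largest Q xs) ∎
  where L = largest P (map suc xs)

largest-oneTo-stable : ∀ P {m n} → m ≤′ n → (∀ i → m < i → P i ≡ false) →
                       largest P (oneTo n) ≡ largest P (oneTo m)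
largest-oneTo-stable P ≤′-refl          h = refl
largest-oneTo-stable P {m} (≤′-step {n} m≤′n) h = begin
  largest P (oneTo (suc n))                  ≡⟨ cong (largest P) (oneTo-∷ʳ n) ⟩
  largest P (oneTo n ∷ʳ suc n)               ≡⟨ foldr-∷ʳ (largestStep P) 0 (suc n) (oneTo n) ⟩
  foldr (largestStep P) (largestStep P (suc n) 0) (oneTo n)
    ≡⟨ cong (λ b → foldr (largestStep P) (if b then suc n ⊔ 0 else 0) (oneTo n))
            (h (suc n) (s≤s (≤′⇒≤ m≤′n))) ⟩
  largest P (oneTo n)                        ≡⟨ largest-oneTo-stable P m≤′n h ⟩
  largest P (oneTo m)                        ∎

rank-≤ : ∀ {b l} → Partition≤ b l → rank l ≤ b
rank-≤ {l = l} p = largest-≤ (onDiagonal l) (oneTo (length l))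
  λ i i≤λᵢ → ≤-trans (≤ᵇ⇒≤ i (part l i) i≤λᵢ) (part-Partition≤ p i)

onDiagonal-hook : ∀ {b} x {r} → Partition≤ b r → ∀ i →
                  onDiagonal (suc x ∷ r) (suc i) ≡ onDiagonal (dropFirstColumn r) i
onDiagonal-hook x p zero    = refl
onDiagonal-hook x {r} p (suc i) with part r (suc i) | part-dropFirstColumn p (suc i)
... | zero  | eq rewrite eq = refl
... | suc _ | eq rewrite eq = refl

rank-hook : ∀ {b} x {r} → Partition≤ b r → rank (suc x ∷ r) ≡ suc (rank (dropFirstColumn r))
rank-hook x {r} p = begin
  rank (suc x ∷ r)                                        ≡⟨ cong (largest (onDiagonal l)) (oneTo-suc (length r)) ⟩
  1 ⊔ largest (onDiagonal l) (map suc (oneTo (length r)))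
    ≡⟨ largest-map-suc (onDiagonal l) (onDiagonal μ) (oneTo (length r)) (onDiagonal-hook x p) ⟩
  suc (largest (onDiagonal μ) (oneTo (length r)))
    ≡⟨ cong suc (largest-oneTo-stable (onDiagonal μ) (≤⇒≤′ (length-dropFirstColumn r)) off-diagonal) ⟩
  suc (rank μ)                                            ∎
  where
  l = suc x ∷ r
  μ = dropFirstColumn r
  off-diagonal : ∀ i → length μ < i → onDiagonal μ i ≡ false
  off-diagonal (suc i) μ<i rewrite part-beyond-length μ μ<i = refl

arm : List ℕ → ℕ → ℕ
arm l i = part l i ∸ i

leg : List ℕ → ℕ → ℕ
leg l i = conjPart l i ∸ i

frobenius : List ℕ → List ℕ
frobenius l = map (arm l) (oneTo (rank l))

map-oneTo-suc : ∀ {A : Set} (f : ℕ → A) n → map f (oneTo (suc n)) ≡ f 1 ∷ map (f ∘ suc) (oneTo n)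
map-oneTo-suc f n = trans (cong (map f) (oneTo-suc n)) (cong (f 1 ∷_) (sym (map-∘ (oneTo n))))

map-oneTo-cong : ∀ {A : Set} {f g : ℕ → A} n → (∀ {i} → i < n → f (suc i) ≡ g (suc i)) →
                 map f (oneTo n) ≡ map g (oneTo n)
map-oneTo-cong zero    h = refl
map-oneTo-cong {f = f} {g} (suc n) h = begin
  map f (oneTo (suc n))              ≡⟨ map-oneTo-suc f n ⟩
  f 1 ∷ map (f ∘ suc) (oneTo n)      ≡⟨ cong₂ _∷_ (h (s≤s z≤n)) (map-oneTo-cong n (h ∘ s≤s)) ⟩
  g 1 ∷ map (g ∘ suc) (oneTo n)      ≡⟨ map-oneTo-suc g n ⟨
  map g (oneTo (suc n))              ∎

arm-hook : ∀ {b} x {r} → Partition≤ b r → ∀ i →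
           arm (suc x ∷ r) (suc (suc i)) ≡ arm (dropFirstColumn r) (suc i)
arm-hook x {r} p i = begin
  part r (suc i) ∸ (1 + suc i)   ≡⟨ ∸-+-assoc (part r (suc i)) 1 (suc i) ⟨
  part r (suc i) ∸ 1 ∸ suc i     ≡⟨ cong (_∸ suc i) (part-dropFirstColumn p (suc i)) ⟨
  arm (dropFirstColumn r) (suc i) ∎

leg-hook : ∀ {x} r {i} → i < x → leg (suc x ∷ r) (suc (suc i)) ≡ leg (dropFirstColumn r) (suc i)
leg-hook {x} r {i} i<x = begin
  conjPart (suc x ∷ r) (suc (suc i)) ∸ suc (suc i)
    ≡⟨ cong (λ xs → length xs ∸ suc (suc i)) (filter-accept (suc (suc i) ≤?_) (s≤s i<x)) ⟩
  conjPart r (suc (suc i)) ∸ suc i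
    ≡⟨ cong (_∸ suc i) (conjPart-dropFirstColumn r i) ⟨
  leg (dropFirstColumn r) (suc i) ∎

frobenius-hook : ∀ {b} x {r} → Partition≤ b r → frobenius (suc x ∷ r) ≡ x ∷ frobenius (dropFirstColumn r)
frobenius-hook x {r} p = begin
  map (arm l) (oneTo (rank l))                  ≡⟨ cong (map (arm l) ∘ oneTo) (rank-hook x p) ⟩
  map (arm l) (oneTo (suc (rank μ)))            ≡⟨ map-oneTo-suc (arm l) (rank μ) ⟩
  x ∷ map (arm l ∘ suc) (oneTo (rank μ))        ≡⟨ cong (x ∷_) (map-oneTo-cong (rank μ) λ {i} _ → arm-hook x p i) ⟩
  x ∷ frobenius μ                               ∎
  where
  l = suc x ∷ r
  μ = dropFirstColumn r

isZAsymmetric-hook : ∀ z x {r} → Partition≤ (suc x) r →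
  isZAsymmetric z (suc x ∷ r) ≡ (length r ≡ᵇ x + z) ∧ isZAsymmetric z (dropFirstColumn r)
isZAsymmetric-hook z x {r} p = begin
  and (map asym (oneTo (rank l)))                     ≡⟨ cong (and ∘ map asym ∘ oneTo) (rank-hook x p) ⟩
  and (map asym (oneTo (suc (rank μ))))               ≡⟨ cong and (map-oneTo-suc asym (rank μ)) ⟩
  asym 1 ∧ and (map (asym ∘ suc) (oneTo (rank μ)))
    ≡⟨ cong₂ (λ a b → (a ≡ᵇ x + z) ∧ and b) (conjPart-1 p) (map-oneTo-cong (rank μ) inner) ⟩
  (length r ≡ᵇ x + z) ∧ isZAsymmetric z μ              ∎
  where
  l = suc x ∷ r
  μ = dropFirstColumn r
  asym : ℕ → Bool
  asym i = leg l i ≡ᵇ arm l i + z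
  inner : ∀ {i} → i < rank μ → asym (suc (suc i)) ≡ (leg μ (suc i) ≡ᵇ arm μ (suc i) + z)
  inner {i} i<rank = cong₂ (λ a b → a ≡ᵇ b + z)
    (leg-hook r (<-≤-trans i<rank (rank-≤ (dropFirstColumn-Partition≤ p))))
    (arm-hook x p i)

-- Frobenius arms

hook-induction : (P : List ℕ → Set) → P [] →
                 (∀ {x r} → Partition≤ (suc x) r → P (dropFirstColumn r) → P (suc x ∷ r)) →
                 ∀ {b l} → Partition≤ b l → P l
hook-induction P base step = go (<-wellFounded _)
  where
  go : ∀ {b l} → Acc _<_ b → Partition≤ b l → P l
  go _         []             = base
  go (acc rec) (cons x<b p)   = step p (go (rec x<b) (dropFirstColumn-Partition≤ p))

frobenius-descending : ∀ {b l} → Partition≤ b l → Linked _>_ (b ∷ frobenius l)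
frobenius-descending p = hook-induction Descending (λ _ → [-]) step p p
  where
  Descending : List ℕ → Set
  Descending l = ∀ {b} → Partition≤ b l → Linked _>_ (b ∷ frobenius l)

  step : ∀ {x r} → Partition≤ (suc x) r → Descending (dropFirstColumn r) → Descending (suc x ∷ r)
  step {x} p ih (cons x<b _) rewrite frobenius-hook x p = x<b ∷ ih (dropFirstColumn-Partition≤ p)

fromFrobenius : ℕ → List ℕ → List ℕ
fromFrobenius z []       = []
fromFrobenius z (a ∷ as) = suc a ∷ addFirstColumn (a + z) (fromFrobenius z as)

fromFrobenius-frobenius : ∀ z {b l} → Partition≤ b l → T (isZAsymmetric z l) →
                          fromFrobenius z (frobenius l) ≡ l
fromFrobenius-frobenius z = hook-induction Recovered (λ _ → refl) step
  where
  Recovered : List ℕ → Set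
  Recovered l = T (isZAsymmetric z l) → fromFrobenius z (frobenius l) ≡ l

  step : ∀ {x r} → Partition≤ (suc x) r → Recovered (dropFirstColumn r) → Recovered (suc x ∷ r)
  step {x} {r} p ih asym =
    let length≡x+z , asymμ = ∧-elim {length r ≡ᵇ x + z} (subst T (isZAsymmetric-hook z x p) asym) in
    begin
    fromFrobenius z (frobenius (suc x ∷ r))
      ≡⟨ cong (fromFrobenius z) (frobenius-hook x p) ⟩
    suc x ∷ addFirstColumn (x + z) (fromFrobenius z (frobenius (dropFirstColumn r)))
      ≡⟨ cong₂ (λ n ν → suc x ∷ addFirstColumn n ν) (sym (≡ᵇ⇒≡ (length r) (x + z) length≡x+z)) (ih asymμ) ⟩
    suc x ∷ addFirstColumn (length r) (dropFirstColumn r)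
      ≡⟨ cong (suc x ∷_) (addFirstColumn-dropFirstColumn p) ⟩
    suc x ∷ r
      ∎

length-fromFrobenius : ∀ z {c α} → Linked _>_ (c ∷ α) → length (fromFrobenius z α) ≤ c + z
length-fromFrobenius z [-]                      = z≤n
length-fromFrobenius z {α = a ∷ as} (a<c ∷ α↓) =
  ≤-trans (≤-reflexive (cong suc (length-addFirstColumn (fromFrobenius z as) (length-fromFrobenius z α↓))))
          (+-monoˡ-≤ z a<c)

fromFrobenius-Partition≤ : ∀ z {c α} → Linked _>_ (c ∷ α) → Partition≤ c (fromFrobenius z α)
fromFrobenius-Partition≤ z [-]                    = []
fromFrobenius-Partition≤ z {α = a ∷ _} (a<c ∷ α↓) =
  cons a<c (addFirstColumn-Partition≤ (a + z) (fromFrobenius-Partition≤ z α↓))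

hookLength : ℕ → ℕ → ℕ
hookLength z a = suc (a * 2 + z)

sum-fromFrobenius : ∀ z {α} → Linked _>_ α → sum (fromFrobenius z α) ≡ sum (map (hookLength z) α)
sum-fromFrobenius z {[]}     _  = refl
sum-fromFrobenius z {a ∷ as} α↓ = begin
  suc a + sum (addFirstColumn (a + z) B)
    ≡⟨ cong (suc a +_) (sum-addFirstColumn B (length-fromFrobenius z α↓)) ⟩
  suc a + (sum B + (a + z))
    ≡⟨ cong (λ s → suc a + (s + (a + z))) (sum-fromFrobenius z (Linked.tail α↓)) ⟩
  suc a + (sum (map (hookLength z) as) + (a + z))
    ≡⟨ hook-sum a (sum (map (hookLength z) as)) z ⟩
  hookLength z a + sum (map (hookLength z) as)   ∎
  where
  B = fromFrobenius z as
  hook-sum : ∀ a s z → suc a + (s + (a + z)) ≡ suc (a * 2 + z) + s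
  hook-sum = solve-∀

frobenius-fromFrobenius : ∀ z {α} → Linked _>_ α → frobenius (fromFrobenius z α) ≡ α
frobenius-fromFrobenius z {[]}     _  = refl
frobenius-fromFrobenius z {a ∷ as} α↓ = begin
  frobenius (suc a ∷ addFirstColumn (a + z) B)
    ≡⟨ frobenius-hook a (addFirstColumn-Partition≤ (a + z) B≤a) ⟩
  a ∷ frobenius (dropFirstColumn (addFirstColumn (a + z) B))
    ≡⟨ cong (λ μ → a ∷ frobenius μ) (dropFirstColumn-addFirstColumn (a + z) B≤a) ⟩
  a ∷ frobenius B          ≡⟨ cong (a ∷_) (frobenius-fromFrobenius z (Linked.tail α↓)) ⟩
  a ∷ as                   ∎
  where
  B = fromFrobenius z as
  B≤a = fromFrobenius-Partition≤ z α↓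

isZAsymmetric-fromFrobenius : ∀ z {α} → Linked _>_ α → T (isZAsymmetric z (fromFrobenius z α))
isZAsymmetric-fromFrobenius z {[]}     _  = _
isZAsymmetric-fromFrobenius z {a ∷ as} α↓ = subst T (sym (isZAsymmetric-hook z a B′≤1+a))
  (∧-intro (≡⇒≡ᵇ _ _ (length-addFirstColumn B (length-fromFrobenius z α↓)))
           (subst (T ∘ isZAsymmetric z) (sym (dropFirstColumn-addFirstColumn (a + z) B≤a))
                  (isZAsymmetric-fromFrobenius z (Linked.tail α↓))))
  where
  B = fromFrobenius z as
  B≤a = fromFrobenius-Partition≤ z α↓
  B′≤1+a = addFirstColumn-Partition≤ (a + z) B≤a

-- Hook lengths

hookArm : ℕ → ℕ → ℕ
hookArm z p = (p ∸ suc z) / 2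

hookLength-isOddShift : ∀ z a → T (isOddShift z (hookLength z a))
hookLength-isOddShift z a = ∧-intro (≤⇒≤ᵇ (s≤s (m≤n+m z (a * 2))))
  (subst (λ d → T (d % 2 ≡ᵇ 0)) (sym (m+n∸n≡m (a * 2) z)) (≡⇒≡ᵇ _ 0 (m*n%n≡0 a 2)))

hookArm-hookLength : ∀ z a → hookArm z (hookLength z a) ≡ a
hookArm-hookLength z a = trans (cong (_/ 2) (m+n∸n≡m (a * 2) z)) (m*n/n≡m a 2)

hookLength-hookArm : ∀ z {p} → T (isOddShift z p) → hookLength z (hookArm z p) ≡ p
hookLength-hookArm z {p} odd = begin
  suc (d / 2 * 2 + z)   ≡⟨ cong (λ e → suc (e + z)) d≡d/2*2 ⟨
  suc (d + z)           ≡⟨ +-suc d z ⟨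
  d + suc z             ≡⟨ m∸n+n≡m (≤ᵇ⇒≤ (suc z) p 1+z≤p) ⟩
  p                     ∎
  where
  d = p ∸ suc z
  odd′ = ∧-elim {suc z ≤ᵇ p} odd
  1+z≤p = proj₁ odd′
  d≡d/2*2 : d ≡ d / 2 * 2
  d≡d/2*2 = trans (m≡m%n+[m/n]*n d 2) (cong (_+ d / 2 * 2) (≡ᵇ⇒≡ (d % 2) 0 (proj₂ odd′)))

hookLength-mono-< : ∀ z {a b} → a < b → hookLength z a < hookLength z b
hookLength-mono-< z a<b = s≤s (+-monoˡ-< z (*-monoˡ-< 2 a<b))

hookLength-cancel-< : ∀ z {a b} → hookLength z a < hookLength z b → a < b
hookLength-cancel-< z {a} {b} (s≤s lt) = *-cancelʳ-< 2 a b (+-cancelʳ-< z (a * 2) (b * 2) lt)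

Σ-T-≡ : ∀ {A : Set} {P : A → Bool} {x y} {p : T (P x)} {q : T (P y)} → x ≡ y →
        _≡_ {A = Σ A (T ∘ P)} (x , p) (y , q)
Σ-T-≡ refl = cong (_ ,_) (T-irrelevant _ _)

fromFrobenius-isPartitionOf : ∀ z {m α} → Linked _>_ α → sum (map (hookLength z) α) ≡ m →
                              T (isPartitionOf m (fromFrobenius z α))
fromFrobenius-isPartitionOf z {α = []}    _  sum≡m = Partition≤⇒isPartitionOf {b = 0} [] sum≡m
fromFrobenius-isPartitionOf z {α = a ∷ _} α↓ sum≡m =
  Partition≤⇒isPartitionOf (fromFrobenius-Partition≤ z (≤-refl ∷ α↓)) (trans (sum-fromFrobenius z α↓) sum≡m)

isFrobeniusArmsOf : ℕ → ℕ → List ℕ → Bool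
isFrobeniusArmsOf z m α = strictlyDecreasing α ∧ (sum (map (hookLength z) α) ≡ᵇ m)

module _ (z m : ℕ) where

  ZAsymmetricPartitions : Set
  ZAsymmetricPartitions = Σ (List ℕ) (λ l → T (isPartitionOf m l ∧ isZAsymmetric z l))

  FrobeniusArms : Set
  FrobeniusArms = Σ (List ℕ) (T ∘ isFrobeniusArmsOf z m)

  DistinctOddShiftPartitions : Set
  DistinctOddShiftPartitions = Σ (List ℕ) (T ∘ isDistinctOddShiftPartitionOf z m)

  zAsymmetric↔frobeniusArms : ZAsymmetricPartitions ↔ FrobeniusArms
  zAsymmetric↔frobeniusArms = mk↔ₛ′ to from to∘from from∘to
    where
    arms↓ : ∀ α → T (isFrobeniusArmsOf z m α) → Linked _>_ α
    arms↓ α t = strictlyDecreasing⇒Linked α (proj₁ (∧-elim {strictlyDecreasing α} t))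

    frobenius-section : ∀ l → T (isPartitionOf m l ∧ isZAsymmetric z l) →
                        Linked _>_ (frobenius l) × fromFrobenius z (frobenius l) ≡ l × sum l ≡ m
    frobenius-section l t =
      let partition , asym       = ∧-elim {isPartitionOf m l} t
          (b , l≤b) , sum≡m      = isPartitionOf⇒Partition≤ l partition
      in Linked.tail (frobenius-descending l≤b) , fromFrobenius-frobenius z l≤b asym , sum≡m

    to : ZAsymmetricPartitions → FrobeniusArms
    to (l , t) =
      let α↓ , recovered , sum≡m = frobenius-section l t in
      frobenius l , ∧-intro (Linked⇒strictlyDecreasing α↓) (≡⇒≡ᵇ _ m (begin
        sum (map (hookLength z) (frobenius l))     ≡⟨ sum-fromFrobenius z α↓ ⟨
        sum (fromFrobenius z (frobenius l))        ≡⟨ cong sum recovered ⟩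
        sum l                                      ≡⟨ sum≡m ⟩
        m                                          ∎))

    from : FrobeniusArms → ZAsymmetricPartitions
    from (α , t) = fromFrobenius z α , ∧-intro
      (fromFrobenius-isPartitionOf z (arms↓ α t) (≡ᵇ⇒≡ _ m (proj₂ (∧-elim {strictlyDecreasing α} t))))
      (isZAsymmetric-fromFrobenius z (arms↓ α t))

    to∘from : ∀ a → to (from a) ≡ a
    to∘from (α , t) = Σ-T-≡ (frobenius-fromFrobenius z (arms↓ α t))

    from∘to : ∀ l → from (to l) ≡ l
    from∘to (l , t) = Σ-T-≡ (proj₁ (proj₂ (frobenius-section l t)))

  frobeniusArms↔distinctOddShift : FrobeniusArms ↔ DistinctOddShiftPartitions
  frobeniusArms↔distinctOddShift = mk↔ₛ′ to from to∘from from∘to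
    where
    map-hookLength-hookArm : ∀ h → T (all (isOddShift z) h) → map (hookLength z) (map (hookArm z) h) ≡ h
    map-hookLength-hookArm h odd =
      trans (sym (map-∘ h)) (map-id-local (All.map (hookLength-hookArm z) (all⁺ (isOddShift z) h odd)))

    map-hookArm-hookLength : ∀ α → map (hookArm z) (map (hookLength z) α) ≡ α
    map-hookArm-hookLength α = trans (sym (map-∘ α)) (map-id-local (All.universal (hookArm-hookLength z) α))

    to : FrobeniusArms → DistinctOddShiftPartitions
    to (α , t) =
      let decreasing , sum≡m = ∧-elim {strictlyDecreasing α} t in
      map (hookLength z) α , ∧-intro
        (Linked⇒strictlyDecreasing
          (Linked.map⁺ (Linked.map (hookLength-mono-< z) (strictlyDecreasing⇒Linked α decreasing))))
        (∧-intro (all⁻ (isOddShift z) (All.map⁺ (All.universal (hookLength-isOddShift z) α))) sum≡m)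

    from : DistinctOddShiftPartitions → FrobeniusArms
    from (h , t) =
      let decreasing , rest = ∧-elim {strictlyDecreasing h} t
          odd , sum≡m       = ∧-elim {all (isOddShift z) h} rest
          h≡ = map-hookLength-hookArm h odd
      in map (hookArm z) h , ∧-intro
        (Linked⇒strictlyDecreasing (Linked.map (hookLength-cancel-< z)
          (Linked.map⁻ (subst (Linked _>_) (sym h≡) (strictlyDecreasing⇒Linked h decreasing)))))
        (subst (λ xs → T (sum xs ≡ᵇ m)) (sym h≡) sum≡m)

    to∘from : ∀ h → to (from h) ≡ h
    to∘from (h , t) =
      let odd = proj₁ (∧-elim {all (isOddShift z) h} (proj₂ (∧-elim {strictlyDecreasing h} t))) in
      Σ-T-≡ (map-hookLength-hookArm h odd)

    from∘to : ∀ α → from (to α) ≡ α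
    from∘to (α , _) = Σ-T-≡ (map-hookArm-hookLength α)

proposition6p1 : (z m : ℕ) →
    Σ (List ℕ) (λ l → T (isPartitionOf m l ∧ isZAsymmetric z l))
      ↔ Σ (List ℕ) (λ l → T (isDistinctOddShiftPartitionOf z m l))
proposition6p1 z m = ↔-trans (zAsymmetric↔frobeniusArms z m) (frobeniusArms↔distinctOddShift z m)
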